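{- Let $n\ge2$ and $B=B(\mathrm{Path}_n)=\{[j,k]: 1\le j\le k\le n\}$. Let $O$ be the flag ordering of $B$ with decomposition $D=\{\{1\},\{2\},\dots,\{n\},[2],[3],\dots,[n]\}$ in which elements $a,b\in B\setminus D$ are ordered with $a$ earlier than $b$ if either $\max(a)<\max(b)$, or $\max(a)=\max(b)$ and $|a|>|b|$. Then $\Gamma(O)\cong\Gamma(\widehat{\mathfrak{S}}_n(312))$, where the bijection on vertices is $v([a+1,b+1])\mapsto(a,b)$.
   Context: Here $[j,k]=\{j,j+1,\dots,k\}$ and $[m]=[1,m]$. A building set $B$ on a finite set $S$ is a collection of nonempty subsets of $S$ closed under unions of intersecting pairs and containing all singletons. A flag ordering $O=(D,b_1,\dots,b_k)$ of a connected flag building set $B$ on $[n]$ is a decomposition $D$ of $[n]$ in $B$ (a subset of $B$ forming the collection of leaf-descendant sets of the vertices of a rooted binary tree with leaf set $[n]$) together with an enumeration $b_1,\dots,b_k$ of $B\setminus D$ such that each $B_j:=D\cup\{b_1,\dots,b_j\}$ ($0\le j\le k$) is a flag building set. For $j\in[k]$: $U_j=\{i<j: b_i\not\subseteq b_j$ and there is no $b\in B_{i-1}$ with $b\setminus b_j=b_i\setminus b_j\}$; $V_j=\{i<j: b_i\subseteq b_j$ and there is $b\in B_{i-1}$ with $b_i\subsetneq b\subsetneq b_j\}$. $\Gamma(O)$ is the clique complex of the graph on vertices $v(b_1),\dots,v(b_k)$ in which, for $i<j$, $v(b_i)\sim v(b_j)$ iff $i\in U_j\cup V_j$. For distinct integers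 $a<b$, $c<d$, the pairs $(a,b),(c,d)$ are non-crossing if $a<c<d<b$, or $c<a<b<d$, or $a<b<c<d$, or $c<d<a<b$. $\Gamma(\widehat{\mathfrak{S}}_n(312))$ is the flag complex on vertex set $\{(a,b): 1\le a<b\le n-1\}$ whose faces are the sets of vertices that are pairwise non-crossing (pairs sharing an entry are not non-crossing). -}

module Defs where

open import Data.Nat using (ℕ; zero; suc; _+_; _∸_; _≤_; _<_; _⊔_)
open import Data.Product using (Σ; _×_; _,_; proj₁; proj₂)
open import Data.Sum using (_⊎_)
open import Data.List using (List; map)
open import Data.List.Relation.Unary.All using (All)
open import Data.List.Membership.Propositional using (_∈_)
open import Relation.Nullary using (¬_)
open import Relation.Binary.PropositionalEquality using (_≡_; _≢_)
open import Function.Bundles using (_⇔_)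

Itv : Set
Itv = ℕ × ℕ

_∈I_ : ℕ → Itv → Set
x ∈I (j , k) = j ≤ x × x ≤ k

_⊆I_ : Itv → Itv → Set
a ⊆I b = ∀ x → x ∈I a → x ∈I b

_⊊I_ : Itv → Itv → Set
a ⊊I b = a ⊆I b × ¬ (b ⊆I a)

maxI : Itv → ℕ
maxI (j , k) = k

sizeI : Itv → ℕ
sizeI (j , k) = suc k ∸ j

InB : ℕ → Itv → Set
InB n (j , k) = 1 ≤ j × j ≤ k × k ≤ n

-- D = {{1},...,{n},[2],...,[n]} : the singletons [i,i] and the intervals [1,k]
-- (for an element of B)
InD : Itv → Set
InD (j , k) = j ≡ 1 ⊎ j ≡ k

InBminusD : ℕ → Itv → Set
InBminusD n a = InB n a × ¬ InD a

Earlier : Itv → Itv → Set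
Earlier a b = maxI a < maxI b ⊎ (maxI a ≡ maxI b × sizeI b < sizeI a)

-- b ∈ B_{i-1} = D ∪ {b_1,...,b_{i-1}}, where c = b_i
InBbefore : ℕ → Itv → Itv → Set
InBbefore n b c = InB n b × (InD b ⊎ (¬ InD b × Earlier b c))

DiffEq : Itv → Itv → Itv → Set
DiffEq b c d = ∀ x → (x ∈I b × ¬ (x ∈I d)) ⇔ (x ∈I c × ¬ (x ∈I d))

-- i ∈ U_j  (bi = b_i, bj = b_j, with b_i earlier than b_j)
UCond : ℕ → Itv → Itv → Set
UCond n bi bj = ¬ (bi ⊆I bj) × ¬ (Σ Itv λ b → InBbefore n b bi × DiffEq b bi bj)

VCond : ℕ → Itv → Itv → Set
VCond n bi bj = bi ⊆I bj × Σ Itv λ b → InBbefore n b bi × bi ⊊I b × b ⊊I bj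

AdjO : ℕ → Itv → Itv → Set
AdjO n u v = (Earlier u v × (UCond n u v ⊎ VCond n u v))
           ⊎ (Earlier v u × (UCond n v u ⊎ VCond n v u))

-- faces of Γ(O) (clique complex), a face given by a list of its vertices
FaceO : ℕ → List Itv → Set
FaceO n L = All (InBminusD n) L × (∀ u v → u ∈ L → v ∈ L → u ≢ v → AdjO n u v)

Vert312 : ℕ → ℕ × ℕ → Set
Vert312 n (a , b) = 1 ≤ a × a < b × b ≤ n ∸ 1

NonCrossing : ℕ × ℕ → ℕ × ℕ → Set
NonCrossing (a , b) (c , d) =
  (a < c × c < d × d < b) ⊎ (c < a × a < b × b < d) ⊎
  (a < b × b < c × c < d) ⊎ (c < d × d < a × a < b)

Face312 : ℕ → List (ℕ × ℕ) → Set
Face312 n L = All (Vert312 n) L × (∀ p q → p ∈ L → q ∈ L → p ≢ q → NonCrossing p q)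

vmap : Itv → ℕ × ℕ
vmap (j , k) = (j ∸ 1 , k ∸ 1)

-- A vertex [a,b] of Γ(O) is an interval with 2 ≤ a < b.  For [a,b] earlier than [c,d]:
-- the V-condition holds exactly when [a,b] is strictly nested in [c,d], the witness being
-- [a-1,b]; if instead a = c, an intermediate interval would be some [a,f] with f ≥ b, which
-- lies in D or comes after [a,b].  The U-condition holds exactly when [a,b] lies left of
-- [c,d]: if they overlap with a < c ≤ b, the earlier interval [a,c-1] has the same
-- difference with [c,d] as [a,b].  Thus adjacency is non-crossing, shifted by one.
module Submission where

open import Defs
open import Data.Nat using (ℕ; zero; suc; _≤_; _<_; s≤s; s≤s⁻¹; _≤?_; _<?_)
open import Data.Nat.Properties
open import Data.Product using (Σ; _×_; _,_; proj₁; proj₂)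
open import Data.Sum using (_⊎_; inj₁; inj₂)
import Data.Sum as Sum
open import Data.Empty using (⊥-elim)
open import Data.List using (List; map)
open import Data.List.Relation.Unary.All using (All)
import Data.List.Relation.Unary.All as All
import Data.List.Relation.Unary.All.Properties as All
open import Data.List.Membership.Propositional using (_∈_)
open import Data.List.Membership.Propositional.Properties using (∈-map⁺; ∈-map⁻)
open import Relation.Nullary using (¬_; yes; no)
open import Relation.Binary.PropositionalEquality using (_≡_; _≢_; refl; sym; cong)
open import Function.Base using (_∘_)
open import Function.Bundles using (_⇔_; mk⇔; Equivalence)
import Function.Properties.Equivalence as ⇔

open Equivalence

private
  variable
    n a b c d e f k : ℕ

⊆I⇔ : a ≤ b → (a , b) ⊆I (c , d) ⇔ (c ≤ a × b ≤ d)
⊆I⇔ a≤b = mk⇔ (λ a⊆ → proj₁ (a⊆ _ (≤-refl , a≤b)) , proj₂ (a⊆ _ (a≤b , ≤-refl)))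
               (λ (c≤a , b≤d) x (a≤x , x≤b) → ≤-trans c≤a a≤x , ≤-trans x≤b b≤d)

⊊I-intro : a ≤ b → c ≤ a → b ≤ d → c < a ⊎ b < d → (a , b) ⊊I (c , d)
⊊I-intro {a = a} {b = b} {c = c} {d = d} a≤b c≤a b≤d strict =
  from (⊆I⇔ a≤b) (c≤a , b≤d) , not-reverse strict
  where
  c≤d = ≤-trans c≤a (≤-trans a≤b b≤d)
  not-reverse : c < a ⊎ b < d → ¬ ((c , d) ⊆I (a , b))
  not-reverse (inj₁ c<a) c⊆ = <⇒≱ c<a (proj₁ (to (⊆I⇔ c≤d) c⊆))
  not-reverse (inj₂ b<d) c⊆ = <⇒≱ b<d (proj₂ (to (⊆I⇔ c≤d) c⊆))

InBminusD⇔bounds : InBminusD n (a , b) ⇔ (2 ≤ a × a < b × b ≤ n)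
InBminusD⇔bounds = mk⇔
  (λ ((1≤a , a≤b , b≤n) , ∉D) →
     ≤∧≢⇒< 1≤a (λ 1≡a → ∉D (inj₁ (sym 1≡a))) , ≤∧≢⇒< a≤b (λ a≡b → ∉D (inj₂ a≡b)) , b≤n)
  (λ (2≤a , a<b , b≤n) →
     (<⇒≤ 2≤a , <⇒≤ a<b , b≤n) , λ { (inj₁ refl) → <⇒≱ 2≤a ≤-refl
                                  ; (inj₂ refl) → <-irrefl refl a<b })

sizeI-suc< : a ≤ b → sizeI (suc a , b) < sizeI (a , b)
sizeI-suc< a≤b rewrite +-∸-assoc 1 a≤b = ≤-refl

¬InBbefore-extension : 2 ≤ a → a < b → b ≤ f → ¬ InBbefore n (a , f) (a , b)
¬InBbefore-extension 2≤a a<b b≤f (_ , inj₁ (inj₁ a≡1)) = <⇒≱ 2≤a (≤-reflexive a≡1)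
¬InBbefore-extension 2≤a a<b b≤f (_ , inj₁ (inj₂ refl)) = <⇒≱ a<b b≤f
¬InBbefore-extension 2≤a a<b b≤f (_ , inj₂ (_ , inj₁ f<b)) = <⇒≱ f<b b≤f
¬InBbefore-extension 2≤a a<b b≤f (_ , inj₂ (_ , inj₂ (refl , size<))) = <-irrefl refl size<

¬InBbefore-superset : 2 ≤ a → a < b → (a , b) ⊆I (e , f) → a ≤ e → ¬ InBbefore n (e , f) (a , b)
¬InBbefore-superset 2≤a a<b a⊆e a≤e with to (⊆I⇔ (<⇒≤ a<b)) a⊆e
... | e≤a , b≤f rewrite ≤-antisym e≤a a≤e = ¬InBbefore-extension 2≤a a<b b≤f

nested⇒VCond : 2 ≤ c → c < a → a < b → b < d → d ≤ n → VCond n (a , b) (c , d)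
nested⇒VCond {a = suc a} {b = b} 2≤c c<a a<b b<d d≤n =
  from (⊆I⇔ (<⇒≤ a<b)) (<⇒≤ c<a , <⇒≤ b<d)
  , (a , b) , (inB , inj₂ (∉D , inj₂ (refl , sizeI-suc< a≤b)))
  , ⊊I-intro (<⇒≤ a<b) (n≤1+n a) ≤-refl (inj₁ ≤-refl)
  , ⊊I-intro a≤b (s≤s⁻¹ c<a) (<⇒≤ b<d) (inj₂ b<d)
  where
  a≤b = ≤-trans (n≤1+n a) (<⇒≤ a<b)
  bounds = ≤-trans 2≤c (s≤s⁻¹ c<a) , <-trans ≤-refl a<b , <⇒≤ (<-≤-trans b<d d≤n)
  inB = proj₁ (from InBminusD⇔bounds bounds)
  ∉D = proj₂ (from InBminusD⇔bounds bounds)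

VCond⇒nested : 2 ≤ a → a < b → Earlier (a , b) (c , d) → VCond n (a , b) (c , d) → c < a × b < d
VCond⇒nested {a = a} {b = b} {c = c} {d = d} 2≤a a<b earlier
             (a⊆c , (e , f) , e-before@((_ , e≤f , _) , _) , (a⊆e , _) , (e⊆c , _))
  with to (⊆I⇔ (<⇒≤ a<b)) a⊆c
... | c≤a , b≤d = c<a (m≤n⇒m<n∨m≡n c≤a) , b<d earlier
  where
  c<a : c < a ⊎ c ≡ a → c < a
  c<a (inj₁ c<a) = c<a
  c<a (inj₂ refl) =
    ⊥-elim (¬InBbefore-superset 2≤a a<b a⊆e (proj₁ (to (⊆I⇔ e≤f) e⊆c)) e-before)
  b<d : Earlier (a , b) (c , d) → b < d
  b<d (inj₁ b<d) = b<d
  b<d (inj₂ (refl , size<)) = ⊥-elim (<⇒≱ size< (∸-monoʳ-≤ (suc b) c≤a))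

disjoint⇒UCond : 2 ≤ a → a < b → b < c → UCond n (a , b) (c , d)
disjoint⇒UCond {a = a} {b = b} {c = c} {d = d} 2≤a a<b b<c = a⊈c , no-witness
  where
  a<c = <-trans a<b b<c
  a⊈c : ¬ ((a , b) ⊆I (c , d))
  a⊈c a⊆c = <⇒≱ a<c (proj₁ (to (⊆I⇔ (<⇒≤ a<b)) a⊆c))
  ∉c : ∀ {x} → x < c → ¬ (x ∈I (c , d))
  ∉c x<c (c≤x , _) = <⇒≱ x<c c≤x
  no-witness : ¬ (Σ Itv λ w → InBbefore n w (a , b) × DiffEq w (a , b) (c , d))
  no-witness ((e , f) , before@((_ , e≤f , _) , _) , same-diff) =
    ¬InBbefore-superset 2≤a a<b a⊆e a≤e before
    where
    a⊆e : (a , b) ⊆I (e , f)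
    a⊆e x x∈a = proj₁ (from (same-diff x) (x∈a , ∉c (≤-<-trans (proj₂ x∈a) b<c)))
    e≤a = proj₁ (to (⊆I⇔ (<⇒≤ a<b)) a⊆e)
    a≤e = proj₁ (proj₁ (to (same-diff e) ((≤-refl , e≤f) , ∉c (≤-<-trans e≤a a<c))))

cut-DiffEq : suc k ≤ b → b ≤ d → DiffEq (a , k) (a , b) (suc k , d)
cut-DiffEq {k = k} {b = b} {d = d} k<b b≤d x = mk⇔
  (λ ((a≤x , x≤k) , x∉) → (a≤x , ≤-trans x≤k (<⇒≤ k<b)) , x∉)
  (λ ((a≤x , x≤b) , x∉) → (a≤x , x≤k x≤b x∉) , x∉)
  where
  x≤k : x ≤ b → ¬ (x ∈I (suc k , d)) → x ≤ k
  x≤k x≤b x∉ with suc k ≤? x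
  ... | yes k<x = ⊥-elim (x∉ (k<x , ≤-trans x≤b b≤d))
  ... | no k≮x = s≤s⁻¹ (≰⇒> k≮x)

overlapping⇒¬UCond : 2 ≤ a → a < b → c ≤ b → b ≤ d → d ≤ n → ¬ UCond n (a , b) (c , d)
overlapping⇒¬UCond {a = a} {b = b} {c = c} 2≤a a<b c≤b b≤d d≤n (a⊈c , no-witness) with a <? c
... | no a≮c = a⊈c (from (⊆I⇔ (<⇒≤ a<b)) (≮⇒≥ a≮c , b≤d))
... | yes (s≤s {n = k} a≤k) =
  no-witness ((a , k) , (inB , ∈D⊎earlier (m≤n⇒m<n∨m≡n a≤k)) , cut-DiffEq c≤b b≤d)
  where
  inB = <⇒≤ 2≤a , a≤k , ≤-trans (n≤1+n k) (≤-trans c≤b (≤-trans b≤d d≤n))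
  ∈D⊎earlier : a < k ⊎ a ≡ k → InD (a , k) ⊎ (¬ InD (a , k) × Earlier (a , k) (a , b))
  ∈D⊎earlier (inj₁ a<k) =
    inj₂ (proj₂ (from InBminusD⇔bounds (2≤a , a<k , proj₂ (proj₂ inB))) , inj₁ c≤b)
  ∈D⊎earlier (inj₂ a≡k) = inj₁ (inj₂ a≡k)

UCond⇒disjoint : 2 ≤ a → a < b → d ≤ n → Earlier (a , b) (c , d) → UCond n (a , b) (c , d) → b < c
UCond⇒disjoint {a = a} {b = b} {d = d} {c = c} 2≤a a<b d≤n earlier u with b <? c
... | yes b<c = b<c
... | no b≮c = ⊥-elim (overlapping⇒¬UCond 2≤a a<b (≮⇒≥ b≮c) (b≤d earlier) d≤n u)
  where
  b≤d : Earlier (a , b) (c , d) → b ≤ d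
  b≤d (inj₁ b<d) = <⇒≤ b<d
  b≤d (inj₂ (b≡d , _)) = ≤-reflexive b≡d

AdjO⇔NonCrossing : InBminusD n (a , b) → InBminusD n (c , d) →
                   AdjO n (a , b) (c , d) ⇔ NonCrossing (a , b) (c , d)
AdjO⇔NonCrossing ab∈ cd∈ with to InBminusD⇔bounds ab∈ | to InBminusD⇔bounds cd∈
... | 2≤a , a<b , b≤n | 2≤c , c<d , d≤n = mk⇔ adjacent⇒nonCrossing nonCrossing⇒adjacent
  where
  adjacent⇒nonCrossing : AdjO _ _ _ → NonCrossing _ _
  adjacent⇒nonCrossing (inj₁ (earlier , inj₁ u)) =
    inj₂ (inj₂ (inj₁ (a<b , UCond⇒disjoint 2≤a a<b d≤n earlier u , c<d)))
  adjacent⇒nonCrossing (inj₁ (earlier , inj₂ v)) with VCond⇒nested 2≤a a<b earlier v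
  ... | c<a , b<d = inj₂ (inj₁ (c<a , a<b , b<d))
  adjacent⇒nonCrossing (inj₂ (earlier , inj₁ u)) =
    inj₂ (inj₂ (inj₂ (c<d , UCond⇒disjoint 2≤c c<d b≤n earlier u , a<b)))
  adjacent⇒nonCrossing (inj₂ (earlier , inj₂ v)) with VCond⇒nested 2≤c c<d earlier v
  ... | a<c , d<b = inj₁ (a<c , c<d , d<b)
  nonCrossing⇒adjacent : NonCrossing _ _ → AdjO _ _ _
  nonCrossing⇒adjacent (inj₁ (a<c , _ , d<b)) =
    inj₂ (inj₁ d<b , inj₂ (nested⇒VCond 2≤a a<c c<d d<b b≤n))
  nonCrossing⇒adjacent (inj₂ (inj₁ (c<a , _ , b<d))) =
    inj₁ (inj₁ b<d , inj₂ (nested⇒VCond 2≤c c<a a<b b<d d≤n))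
  nonCrossing⇒adjacent (inj₂ (inj₂ (inj₁ (_ , b<c , _)))) =
    inj₁ (inj₁ (<-trans b<c c<d) , inj₁ (disjoint⇒UCond 2≤a a<b b<c))
  nonCrossing⇒adjacent (inj₂ (inj₂ (inj₂ (_ , d<a , _)))) =
    inj₂ (inj₁ (<-trans d<a a<b) , inj₁ (disjoint⇒UCond 2≤c c<d d<a))

NonCrossing-suc : NonCrossing (suc a , suc b) (suc c , suc d) ⇔ NonCrossing (a , b) (c , d)
NonCrossing-suc = mk⇔ (Sum.map chain⁻ (Sum.map chain⁻ (Sum.map chain⁻ chain⁻)))
                      (Sum.map chain⁺ (Sum.map chain⁺ (Sum.map chain⁺ chain⁺)))
  where
  Chain : ℕ → ℕ → ℕ → ℕ → Set
  Chain x y z w = x < y × y < z × z < w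
  chain⁻ : ∀ {x y z w} → Chain (suc x) (suc y) (suc z) (suc w) → Chain x y z w
  chain⁻ (p , q , r) = s≤s⁻¹ p , s≤s⁻¹ q , s≤s⁻¹ r
  chain⁺ : ∀ {x y z w} → Chain x y z w → Chain (suc x) (suc y) (suc z) (suc w)
  chain⁺ (p , q , r) = s≤s p , s≤s q , s≤s r

AdjO⇔NonCrossing-vmap : ∀ {u v} → InBminusD n u → InBminusD n v →
                        AdjO n u v ⇔ NonCrossing (vmap u) (vmap v)
AdjO⇔NonCrossing-vmap {u = zero , _} ((() , _) , _) _
AdjO⇔NonCrossing-vmap {u = suc _ , zero} ((_ , () , _) , _) _
AdjO⇔NonCrossing-vmap {u = suc _ , suc _} {zero , _} _ ((() , _) , _)
AdjO⇔NonCrossing-vmap {u = suc _ , suc _} {suc _ , zero} _ ((_ , () , _) , _)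
AdjO⇔NonCrossing-vmap {u = suc _ , suc _} {suc _ , suc _} u∈ v∈ =
  ⇔.trans (AdjO⇔NonCrossing u∈ v∈) NonCrossing-suc

vmap-Vert312 : ∀ x → InBminusD n x → Vert312 n (vmap x)
vmap-Vert312 (zero , _) ((() , _) , _)
vmap-Vert312 (suc _ , zero) ((_ , () , _) , _)
vmap-Vert312 (suc _ , suc _) x∈ with to InBminusD⇔bounds x∈
... | s≤s 1≤a , s≤s a<b , b≤n = 1≤a , a<b , ∸-monoˡ-≤ 1 b≤n

vmap-injective : ∀ x y → InBminusD n x → InBminusD n y → vmap x ≡ vmap y → x ≡ y
vmap-injective (zero , _) _ ((() , _) , _) _
vmap-injective (suc _ , zero) _ ((_ , () , _) , _) _
vmap-injective (suc _ , suc _) (zero , _) _ ((() , _) , _)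
vmap-injective (suc _ , suc _) (suc _ , zero) _ ((_ , () , _) , _)
vmap-injective (suc _ , suc _) (suc _ , suc _) _ _ refl = refl

vmap-surjective : 2 ≤ n → ∀ p → Vert312 n p → Σ Itv λ x → InBminusD n x × vmap x ≡ p
vmap-surjective {suc n} _ (a , b) (1≤a , a<b , b≤n) =
  (suc a , suc b) , from InBminusD⇔bounds (s≤s 1≤a , s≤s a<b , s≤s b≤n) , refl

Clique : {A : Set} → (A → A → Set) → List A → Set
Clique R L = ∀ u v → u ∈ L → v ∈ L → u ≢ v → R u v

Clique-map⇔ : {A B : Set} {P : A → Set} {R : A → A → Set} {S : B → B → Set} {L : List A}
              (g : A → B) → All P L →
              (∀ {u v} → P u → P v → g u ≡ g v → u ≡ v) →
              (∀ {u v} → P u → P v → R u v ⇔ S (g u) (g v)) →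
              Clique R L ⇔ Clique S (map g L)
Clique-map⇔ {P = P} {R} {S} {L} g all-P g-injective R⇔S = mk⇔ R⇒S S⇒R
  where
  P-lookup : ∀ {u} → u ∈ L → P u
  P-lookup = All.lookup all-P
  R⇒S : Clique R L → Clique S (map g L)
  R⇒S R-clique p q p∈ q∈ p≢q with ∈-map⁻ g p∈ | ∈-map⁻ g q∈
  ... | u , u∈ , refl | v , v∈ , refl =
    to (R⇔S (P-lookup u∈) (P-lookup v∈)) (R-clique u v u∈ v∈ (p≢q ∘ cong g))
  S⇒R : Clique S (map g L) → Clique R L
  S⇒R S-clique u v u∈ v∈ u≢v =
    from (R⇔S (P-lookup u∈) (P-lookup v∈))
         (S-clique (g u) (g v) (∈-map⁺ g u∈) (∈-map⁺ g v∈)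
                   (u≢v ∘ g-injective (P-lookup u∈) (P-lookup v∈)))

proposition4p4 : (n : ℕ) → 2 ≤ n →
    ((∀ x → InBminusD n x → Vert312 n (vmap x))
    × (∀ x y → InBminusD n x → InBminusD n y → vmap x ≡ vmap y → x ≡ y)
    × (∀ p → Vert312 n p → Σ Itv λ x → InBminusD n x × vmap x ≡ p))
    × (∀ (L : List Itv) → All (InBminusD n) L → FaceO n L ⇔ Face312 n (map vmap L))
proposition4p4 n 2≤n = (vmap-Vert312 , vmap-injective , vmap-surjective 2≤n) , faces
  where
  faces : ∀ L → All (InBminusD n) L → FaceO n L ⇔ Face312 n (map vmap L)
  faces L all-L = mk⇔ (λ (_ , adjacent) → vertices , to clique adjacent)
                      (λ (_ , nonCrossing) → all-L , from clique nonCrossing)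
    where
    vertices = All.map⁺ (All.map (vmap-Vert312 _) all-L)
    clique = Clique-map⇔ vmap all-L (vmap-injective _ _) AdjO⇔NonCrossing-vmap
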